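{- Let $0\le p\le q$ be integers and let $[p]\times[q]=\{\{c_j,s_k\}: 1\le j\le p,\ 1\le k\le q\}$. Then for every integer $\ell\ge 0$, \[\nu(\ell,[p]\times[q])=\begin{cases}0,& \ell\le p,\\ \ell-p,& p<\ell\le q,\\ 2\ell-p-q,& q<\ell\le p+q,\\ \ell,& \ell>p+q.\end{cases}\]
   Context: $c_1,c_2,\dots$ and $s_1,s_2,\dots$ are distinct vertices. For an integer $\ell\ge0$ and a set $Q$ of pairs $\{c_j,s_k\}$, $\nu(\ell,Q)$ is the matching number of the bipartite graph with vertex classes $\{c_1,\dots,c_\ell\}$ and $\{s_1,\dots,s_\ell\}$ and edge set $\{\{c_j,s_k\}: j,k\le\ell\}\setminus Q$. -}

module Defs where

open import Level using (0ℓ)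
open import Data.Nat using (ℕ; suc; _≤_; _<_)
open import Data.Fin using (Fin; toℕ)
open import Data.Product using (Σ; _×_)
open import Relation.Nullary using (¬_)
open import Relation.Binary.PropositionalEquality using (_≡_)
open import Function.Definitions using (Injective)

-- A set Q of pairs {c_j, s_k} (j, k ≥ 1), given as a predicate on the indices (j , k).
PairSet : Set₁
PairSet = ℕ → ℕ → Set

-- The bipartite graph on {c_1..c_ℓ} ∪ {s_1..s_ℓ} with edge set {{c_j,s_k} : j,k ≤ ℓ} ∖ Q.
-- Vertex c_j (resp. s_k) is represented by  i : Fin ℓ  with  j = 1 + toℕ i.
Edge : (ℓ : ℕ) → PairSet → Fin ℓ → Fin ℓ → Set
Edge ℓ Q a b = ¬ Q (suc (toℕ a)) (suc (toℕ b))

Matching : (ℓ : ℕ) → PairSet → ℕ → Set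
Matching ℓ Q m =
  Σ (Fin m → Fin ℓ) λ f → Σ (Fin m → Fin ℓ) λ g →
    Injective _≡_ _≡_ f × Injective _≡_ _≡_ g × ((i : Fin m) → Edge ℓ Q (f i) (g i))

IsMatchingNumber : (ℓ : ℕ) → PairSet → ℕ → Set
IsMatchingNumber ℓ Q n = Matching ℓ Q n × ((m : ℕ) → Matching ℓ Q m → m ≤ n)

Grid : ℕ → ℕ → PairSet
Grid p q j k = (1 ≤ j × j ≤ p) × (1 ≤ k × k ≤ q)

-- An edge {c_j, s_k} avoids [p] × [q] exactly when j > p or k > q, so the last ℓ ∸ p
-- c-vertices and the last ℓ ∸ q s-vertices cover every edge: ν ≤ (ℓ ∸ p) + (ℓ ∸ q), and
-- trivially ν ≤ ℓ. Matching the top A c-vertices crosswise to the bottom A s-vertices, and the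
-- bottom B c-vertices to the top B s-vertices, attains min(ℓ, (ℓ ∸ p) + (ℓ ∸ q)); the four
-- cases of the theorem are the four values of this minimum.
module Submission where

open import Defs
open import Data.Nat using (ℕ; suc; _≤_; _<_; _+_; _∸_; _⊓_; z≤n; s≤s)
open import Data.Nat.Properties
open import Data.Fin using (Fin; toℕ; fromℕ<; splitAt)
open import Data.Fin.Properties using (toℕ-injective; toℕ<n; toℕ-fromℕ<; fromℕ<-injective; injective⇒≤; +↔⊎)
open import Data.Product using (_×_; _,_)
open import Data.Sum using (_⊎_; inj₁; inj₂; [_,_]′)
open import Data.Sum.Properties using (inj₁-injective; inj₂-injective)
open import Data.Empty using (⊥-elim)
open import Relation.Nullary using (¬_; yes; no)
open import Relation.Binary.PropositionalEquality using (_≡_; _≢_; ≢-sym; sym; cong; subst; subst₂; module ≡-Reasoning)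
open import Function.Base using (_∘_)
open import Function.Bundles using (Injection; mk↣)
open import Function.Definitions using (Injective)
open import Function.Properties.Inverse using (↔⇒↣; ↔-sym)
open import Function.Properties.Injection using (↣-trans)

¬Grid⇒≤⊎≤ : ∀ {p q} a b → ¬ Grid p q (suc a) (suc b) → p ≤ a ⊎ q ≤ b
¬Grid⇒≤⊎≤ {p} {q} a b ¬grid with a <? p | b <? q
... | yes a<p | yes b<q = ⊥-elim (¬grid ((s≤s z≤n , a<p) , (s≤s z≤n , b<q)))
... | no a≮p  | _       = inj₁ (≮⇒≥ a≮p)
... | yes _   | no b≮q  = inj₂ (≮⇒≥ b≮q)

≤⊎≤⇒¬Grid : ∀ {p q a b} → p ≤ a ⊎ q ≤ b → ¬ Grid p q (suc a) (suc b)
≤⊎≤⇒¬Grid (inj₁ p≤a) ((_ , a<p) , _) = <⇒≱ a<p p≤a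
≤⊎≤⇒¬Grid (inj₂ q≤b) (_ , (_ , b<q)) = <⇒≱ b<q q≤b

matching⇒≤ : ∀ {ℓ Q m} → Matching ℓ Q m → m ≤ ℓ
matching⇒≤ (_ , _ , f-injective , _) = injective⇒≤ f-injective

IsTopCover : ℕ → PairSet → ℕ → ℕ → Set
IsTopCover ℓ Q p q = ∀ a b → Edge ℓ Q a b → p ≤ toℕ a ⊎ q ≤ toℕ b

grid-isTopCover : ∀ {ℓ p q} → IsTopCover ℓ (Grid p q) p q
grid-isTopCover a b = ¬Grid⇒≤⊎≤ (toℕ a) (toℕ b)

lowerBy : ∀ {ℓ} p (a : Fin ℓ) → p ≤ toℕ a → Fin (ℓ ∸ p)
lowerBy p a p≤a = fromℕ< (∸-monoˡ-< (toℕ<n a) p≤a)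

lowerBy-injective : ∀ {ℓ p} {a a′ : Fin ℓ} (p≤a : p ≤ toℕ a) (p≤a′ : p ≤ toℕ a′) →
                    lowerBy p a p≤a ≡ lowerBy p a′ p≤a′ → a ≡ a′
lowerBy-injective p≤a p≤a′ eq =
  toℕ-injective (∸-cancelʳ-≡ p≤a p≤a′ (fromℕ<-injective _ _ _ _ eq))

topCover⇒matching≤ : ∀ {ℓ Q p q m} → IsTopCover ℓ Q p q → Matching ℓ Q m →
                     m ≤ (ℓ ∸ p) + (ℓ ∸ q)
topCover⇒matching≤ {ℓ} {Q} {p} {q} {m} cover (f , g , f-injective , g-injective , edge) =
  injective⇒≤ (Injection.injective (↣-trans (mk↣ code-injective) (↔⇒↣ (↔-sym +↔⊎))))
  where
  codeBy : ∀ i → p ≤ toℕ (f i) ⊎ q ≤ toℕ (g i) → Fin (ℓ ∸ p) ⊎ Fin (ℓ ∸ q)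
  codeBy i (inj₁ p≤f) = inj₁ (lowerBy p (f i) p≤f)
  codeBy i (inj₂ q≤g) = inj₂ (lowerBy q (g i) q≤g)

  covered : ∀ i → p ≤ toℕ (f i) ⊎ q ≤ toℕ (g i)
  covered i = cover (f i) (g i) (edge i)

  codeBy-injective : ∀ {i j} cᵢ cⱼ → codeBy i cᵢ ≡ codeBy j cⱼ → i ≡ j
  codeBy-injective (inj₁ p≤fᵢ) (inj₁ p≤fⱼ) eq = f-injective (lowerBy-injective p≤fᵢ p≤fⱼ (inj₁-injective eq))
  codeBy-injective (inj₂ q≤gᵢ) (inj₂ q≤gⱼ) eq = g-injective (lowerBy-injective q≤gᵢ q≤gⱼ (inj₂-injective eq))
  codeBy-injective (inj₁ _) (inj₂ _) ()
  codeBy-injective (inj₂ _) (inj₁ _) ()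

  code-injective : Injective _≡_ _≡_ (λ i → codeBy i (covered i))
  code-injective {i} {j} = codeBy-injective (covered i) (covered j)

matching-fromℕ : ∀ {ℓ Q m} (f g : Fin m → ℕ) → (∀ i → f i < ℓ) → (∀ i → g i < ℓ) →
                 Injective _≡_ _≡_ f → Injective _≡_ _≡_ g →
                 (∀ i → ¬ Q (suc (f i)) (suc (g i))) → Matching ℓ Q m
matching-fromℕ {ℓ} {Q} {m} f g f<ℓ g<ℓ f-injective g-injective edge =
  f′ , g′ , f-injective ∘ fromℕ<-injective _ _ _ _ , g-injective ∘ fromℕ<-injective _ _ _ _ , edge′
  where
  f′ g′ : Fin m → Fin ℓ
  f′ i = fromℕ< (f<ℓ i)
  g′ i = fromℕ< (g<ℓ i)

  edge′ : ∀ i → Edge ℓ Q (f′ i) (g′ i)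
  edge′ i = subst₂ (λ a b → ¬ Q (suc a) (suc b)) (sym (toℕ-fromℕ< (f<ℓ i))) (sym (toℕ-fromℕ< (g<ℓ i))) (edge i)

offsets : ∀ {A B} → ℕ → ℕ → Fin A ⊎ Fin B → ℕ
offsets a b = [ (λ x → a + toℕ x) , (λ y → b + toℕ y) ]′

offsets-< : ∀ {A B a b n} → a + A ≤ n → b + B ≤ n → ∀ k → offsets {A} {B} a b k < n
offsets-< {a = a} a+A≤n _ (inj₁ x) = <-≤-trans (+-monoʳ-< a (toℕ<n x)) a+A≤n
offsets-< {b = b} _ b+B≤n (inj₂ y) = <-≤-trans (+-monoʳ-< b (toℕ<n y)) b+B≤n

offsets-disjoint : ∀ {a b A B x y} → a + A ≤ b ⊎ b + B ≤ a → x < A → y < B → a + x ≢ b + y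
offsets-disjoint {a} {b} {x = x} {y} (inj₁ a+A≤b) x<A _ =
  <⇒≢ (<-≤-trans (+-monoʳ-< a x<A) (≤-trans a+A≤b (m≤m+n b y)))
offsets-disjoint {a} {b} {x = x} {y} (inj₂ b+B≤a) _ y<B =
  ≢-sym (<⇒≢ (<-≤-trans (+-monoʳ-< b y<B) (≤-trans b+B≤a (m≤m+n a x))))

offsets-injective : ∀ {A B a b} → a + A ≤ b ⊎ b + B ≤ a → Injective _≡_ _≡_ (offsets {A} {B} a b)
offsets-injective {a = a} _ {inj₁ x} {inj₁ x′} eq = cong inj₁ (toℕ-injective (+-cancelˡ-≡ a _ _ eq))
offsets-injective {b = b} _ {inj₂ y} {inj₂ y′} eq = cong inj₂ (toℕ-injective (+-cancelˡ-≡ b _ _ eq))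
offsets-injective disjoint {inj₁ x} {inj₂ y} eq = ⊥-elim (offsets-disjoint disjoint (toℕ<n x) (toℕ<n y) eq)
offsets-injective disjoint {inj₂ y} {inj₁ x} eq = ⊥-elim (offsets-disjoint disjoint (toℕ<n x) (toℕ<n y) (sym eq))

∸-swap-≤ : ∀ {m n o} → 0 < n → n ≤ o ∸ m → m ≤ o ∸ n
∸-swap-≤ {m} {n} {o} 0<n n≤o∸m =
  m+n≤o⇒m≤o∸n m (subst (_≤ o) (+-comm n m) (m≤o∸n⇒m+n≤o n m≤o n≤o∸m))
  where
  m≤o : m ≤ o
  m≤o = <⇒≤ (m∸n≢0⇒n<m λ o∸m≡0 → <⇒≱ 0<n (subst (n ≤_) o∸m≡0 n≤o∸m))

grid-crossMatching : ∀ {ℓ p q A B} → A ≤ ℓ ∸ p → B ≤ ℓ ∸ q → A + B ≤ ℓ →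
                     Matching ℓ (Grid p q) (A + B)
grid-crossMatching {ℓ} {p} {q} {A} {B} A≤ℓ∸p B≤ℓ∸q A+B≤ℓ =
  matching-fromℕ {Q = Grid p q} (cOffsets ∘ splitAt A) (sOffsets ∘ splitAt A)
    (cOffsets-< ∘ splitAt A) (sOffsets-< ∘ splitAt A)
    (splitAt-injective ∘ offsets-injective (inj₂ B≤ℓ∸A))
    (splitAt-injective ∘ offsets-injective (inj₁ A≤ℓ∸B))
    (λ i → ≤⊎≤⇒¬Grid (crosses (splitAt A i)))
  where
  cOffsets sOffsets : Fin A ⊎ Fin B → ℕ
  cOffsets = offsets (ℓ ∸ A) 0
  sOffsets = offsets 0 (ℓ ∸ B)

  A≤ℓ : A ≤ ℓ
  A≤ℓ = ≤-trans (m≤m+n A B) A+B≤ℓ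
  B≤ℓ : B ≤ ℓ
  B≤ℓ = ≤-trans (m≤n+m B A) A+B≤ℓ
  A≤ℓ∸B : A ≤ ℓ ∸ B
  A≤ℓ∸B = m+n≤o⇒m≤o∸n A A+B≤ℓ
  B≤ℓ∸A : B ≤ ℓ ∸ A
  B≤ℓ∸A = m+n≤o⇒m≤o∸n B (subst (_≤ ℓ) (+-comm A B) A+B≤ℓ)

  cOffsets-< : ∀ k → cOffsets k < ℓ
  cOffsets-< = offsets-< (≤-reflexive (m∸n+n≡m A≤ℓ)) B≤ℓ
  sOffsets-< : ∀ k → sOffsets k < ℓ
  sOffsets-< = offsets-< A≤ℓ (≤-reflexive (m∸n+n≡m B≤ℓ))

  splitAt-injective : Injective _≡_ _≡_ (splitAt A {B})
  splitAt-injective = Injection.injective (↔⇒↣ +↔⊎)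

  crosses : ∀ k → p ≤ cOffsets k ⊎ q ≤ sOffsets k
  crosses (inj₁ x) = inj₁ (≤-trans (∸-swap-≤ (≤-<-trans z≤n (toℕ<n x)) A≤ℓ∸p) (m≤m+n _ _))
  crosses (inj₂ y) = inj₂ (≤-trans (∸-swap-≤ (≤-<-trans z≤n (toℕ<n y)) B≤ℓ∸q) (m≤m+n _ _))

m+[n∸m]⊓o≡n⊓[m+o] : ∀ {m n} o → m ≤ n → m + ((n ∸ m) ⊓ o) ≡ n ⊓ (m + o)
m+[n∸m]⊓o≡n⊓[m+o] {m} {n} o m≤n = begin
  m + ((n ∸ m) ⊓ o)        ≡⟨ +-distribˡ-⊓ m (n ∸ m) o ⟩
  (m + (n ∸ m)) ⊓ (m + o)  ≡⟨ cong (_⊓ (m + o)) (m+[n∸m]≡n m≤n) ⟩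
  n ⊓ (m + o)              ∎
  where open ≡-Reasoning

νGrid : ℕ → ℕ → ℕ → ℕ
νGrid p q ℓ = ℓ ⊓ ((ℓ ∸ p) + (ℓ ∸ q))

grid-isMatchingNumber : ∀ p q ℓ → IsMatchingNumber ℓ (Grid p q) (νGrid p q ℓ)
grid-isMatchingNumber p q ℓ =
  subst (Matching ℓ (Grid p q)) (m+[n∸m]⊓o≡n⊓[m+o] (ℓ ∸ q) A≤ℓ)
        (grid-crossMatching ≤-refl (m⊓n≤n (ℓ ∸ A) (ℓ ∸ q)) A+B≤ℓ)
  , λ m matching → ⊓-glb (matching⇒≤ {Q = Grid p q} matching)
                          (topCover⇒matching≤ {Q = Grid p q} grid-isTopCover matching)
  where
  A : ℕ
  A = ℓ ∸ p
  A≤ℓ : A ≤ ℓ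
  A≤ℓ = m∸n≤m ℓ p
  A+B≤ℓ : A + ((ℓ ∸ A) ⊓ (ℓ ∸ q)) ≤ ℓ
  A+B≤ℓ = ≤-trans (+-monoʳ-≤ A (m⊓n≤m (ℓ ∸ A) (ℓ ∸ q))) (≤-reflexive (m+[n∸m]≡n A≤ℓ))

νGrid-≤p : ∀ {p q ℓ} → ℓ ≤ p → ℓ ≤ q → νGrid p q ℓ ≡ 0
νGrid-≤p {ℓ = ℓ} ℓ≤p ℓ≤q
  rewrite m≤n⇒m∸n≡0 ℓ≤p | m≤n⇒m∸n≡0 ℓ≤q = ⊓-zeroʳ ℓ

νGrid-≤q : ∀ {p q ℓ} → ℓ ≤ q → νGrid p q ℓ ≡ ℓ ∸ p
νGrid-≤q {p} {q} {ℓ} ℓ≤q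
  rewrite m≤n⇒m∸n≡0 ℓ≤q | +-identityʳ (ℓ ∸ p) = m≥n⇒m⊓n≡n (m∸n≤m ℓ p)

∸+∸≡+∸+ : ∀ {p q ℓ} → p ≤ ℓ → q ≤ ℓ → (ℓ ∸ p) + (ℓ ∸ q) ≡ (ℓ + ℓ) ∸ (p + q)
∸+∸≡+∸+ {p} {q} {ℓ} p≤ℓ q≤ℓ = begin
  (ℓ ∸ p) + (ℓ ∸ q)  ≡⟨ +-∸-assoc (ℓ ∸ p) q≤ℓ ⟨
  ((ℓ ∸ p) + ℓ) ∸ q  ≡⟨ cong (_∸ q) (+-∸-comm ℓ p≤ℓ) ⟨
  ((ℓ + ℓ) ∸ p) ∸ q  ≡⟨ ∸-+-assoc (ℓ + ℓ) p q ⟩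
  (ℓ + ℓ) ∸ (p + q)  ∎
  where open ≡-Reasoning

νGrid-≤p+q : ∀ {p q ℓ} → p ≤ ℓ → q ≤ ℓ → ℓ ≤ p + q → νGrid p q ℓ ≡ (ℓ + ℓ) ∸ (p + q)
νGrid-≤p+q {p} {q} {ℓ} p≤ℓ q≤ℓ ℓ≤p+q = begin
  ℓ ⊓ ((ℓ ∸ p) + (ℓ ∸ q))  ≡⟨ m≥n⇒m⊓n≡n ∸+∸≤ℓ ⟩
  (ℓ ∸ p) + (ℓ ∸ q)        ≡⟨ ∸+∸≡+∸+ p≤ℓ q≤ℓ ⟩
  (ℓ + ℓ) ∸ (p + q)        ∎
  where
  open ≡-Reasoning
  ∸+∸≤ℓ : (ℓ ∸ p) + (ℓ ∸ q) ≤ ℓ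
  ∸+∸≤ℓ = ≤-trans (+-monoˡ-≤ (ℓ ∸ q) (m≤n+o⇒m∸n≤o ℓ p ℓ≤p+q)) (≤-reflexive (m+[n∸m]≡n q≤ℓ))

νGrid-≥p+q : ∀ {p q ℓ} → p + q ≤ ℓ → νGrid p q ℓ ≡ ℓ
νGrid-≥p+q {p} {q} {ℓ} p+q≤ℓ = m≤n⇒m⊓n≡m ℓ≤∸+∸
  where
  ℓ≤∸+∸ : ℓ ≤ (ℓ ∸ p) + (ℓ ∸ q)
  ℓ≤∸+∸ = ≤-trans (m≤n+m∸n ℓ q) (+-monoˡ-≤ (ℓ ∸ q) (m+n≤o⇒m≤o∸n q (subst (_≤ ℓ) (+-comm p q) p+q≤ℓ)))

lemma2p9 : (p q : ℕ) → p ≤ q → (ℓ : ℕ) →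
    (ℓ ≤ p → IsMatchingNumber ℓ (Grid p q) 0)
    × (p < ℓ → ℓ ≤ q → IsMatchingNumber ℓ (Grid p q) (ℓ ∸ p))
    × (q < ℓ → ℓ ≤ p + q → IsMatchingNumber ℓ (Grid p q) ((ℓ + ℓ) ∸ (p + q)))
    × (p + q < ℓ → IsMatchingNumber ℓ (Grid p q) ℓ)
lemma2p9 p q p≤q ℓ =
    (λ ℓ≤p → ν≡ (νGrid-≤p {p} {q} ℓ≤p (≤-trans ℓ≤p p≤q)))
  , (λ _ ℓ≤q → ν≡ (νGrid-≤q {p} ℓ≤q))
  , (λ q<ℓ ℓ≤p+q → ν≡ (νGrid-≤p+q {p} {q} (≤-trans p≤q (<⇒≤ q<ℓ)) (<⇒≤ q<ℓ) ℓ≤p+q))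
  , (λ p+q<ℓ → ν≡ (νGrid-≥p+q {p} {q} (<⇒≤ p+q<ℓ)))
  where
  ν≡ : ∀ {n} → νGrid p q ℓ ≡ n → IsMatchingNumber ℓ (Grid p q) n
  ν≡ eq = subst (IsMatchingNumber ℓ (Grid p q)) eq (grid-isMatchingNumber p q ℓ)
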